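{- Let $S=(S_1,\dots,S_m)\in\mathsf{SVW}_{2,m}$ be a highest weight element and $T=\mathsf{tab}(S)$. (a) Suppose the $1$-word of $S$ ends with a null form starting in position $i$. Then the number of entries of $(S_i,S_{i+1},\dots,S_m)$ containing $1$ equals the number containing $2$; call it $r$. Then $T_{2,r}=m+1-i$, and $r$ is the smallest positive number such that $(1,r+1)\notin T$ or $T_{2,r}<T_{1,r+1}$. (b) Suppose the $1$-word of $S$ ends with a right form, and $T$ has $q$ boxes in row one and $p$ boxes in row two. Then $p<q$ and $T_{2,k}\ge T_{1,k+1}$ for all $1\le k\le p$.
   Context: $\mathsf{SVW}_{2,m}$ is the set of $m$-tuples of subsets of $\{1,2\}$, a $\sqrt{\mathfrak{gl}_2}$-crystal via $S\leftrightarrow S_1\otimes\cdots\otimes S_m$, where on a single $T'\subseteq\{1,2\}$: $\mathrm{wt}(T')=\sum_{j\in T'}\mathbf{e}_j$, $e_1(\{2\})=\{1,2\}$, $e_1(\{1,2\})=\{1\}$, $e_1=0$ otherwise; $f_1(\{1\})=\{1,2\}$, $f_1(\{1,2\})=\{2\}$, $f_1=0$ otherwise; tensor rule $e_1(b\otimes c)=b\otimes e_1(c)$ if $\varepsilon_1(b)\le\varphi_1(c)$ else $e_1(b)\otimes c$, $f_1(b\otimes c)=b\otimes f_1(c)$ if $\varepsilon_1(b)<\varphi_1(c)$ else $f_1(b)\otimes c$, where $\varepsilon_1(b)=\sup\{k:e_1^k(b)\ne0\}$, $\varphi_1(b)=\sup\{k:f_1^k(b)\neq0\}$, $b\otimes0=0\otimes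 c=0$. Highest weight means $e_1(S)=0$. $\mathsf{tab}(S)$ is the left-justified tableau (matrix coordinates, $T_{ij}$ the entry in row $i$, column $j$; $(i,j)\in T$ means the box is filled) whose row $i\in\{1,2\}$ lists the numbers $m+1-j$, over $j$ with $i\in S_j$, in increasing order. The $1$-word of $S$: read $S_1,\dots,S_m$ left to right, writing ")" for $S_j=\{1\}$, "(" for $S_j=\{2\}$, ")$-$(" for $S_j=\{1,2\}$, nothing for $\emptyset$. Its characters are partitioned into the equivalence classes generated by: (ignoring "$-$" and matching parentheses as usual) each matched pair together with everything between lies in one class, and the three characters of each ")$-$(" lie in one class; classes are contiguous. A null form is a class with no unmatched parentheses; a left form has no unmatched ")" and ends with an unmatched "("; a right form has no unmatched "(" and starts with an unmatched ")"; a combined form starts with an unmatched ")" and ends with an unmatched "(". A class starts in position $j$ if its first parenthesis is contributed by $S_j$. -}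

module Defs where

open import Data.Nat using (ℕ; zero; suc; _+_; _*_; _∸_; _≤_; _<_; _≤?_; _≤ᵇ_)
open import Data.Nat.Properties using (≤-decTotalOrder)
open import Data.Bool using (Bool; true; false; if_then_else_)
open import Data.Integer as ℤ using (ℤ)
open import Data.Fin using (Fin; toℕ; fromℕ) renaming (zero to fzero; suc to fsuc)
open import Data.Fin.Subset using (Subset; inside; outside; _∈_)
open import Data.Fin.Subset.Properties using (_∈?_)
open import Data.Vec as Vec using (Vec; []; _∷_)
open import Data.List as List using (List; []; _∷_; length; take; drop; map; filter; zip; upTo; concatMap)
open import Data.List.Sort.InsertionSort.Base ≤-decTotalOrder using (sort)
open import Data.Maybe using (Maybe; just; nothing)
open import Data.Product using (_×_; _,_; proj₁; proj₂; Σ; ∃)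
open import Data.Sum using (_⊎_)
open import Relation.Nullary using (¬_; Dec; yes; no)
open import Relation.Nullary.Decidable using (_×-dec_)
open import Relation.Binary.PropositionalEquality using (_≡_; _≢_)
open import Relation.Binary.Construct.Closure.Equivalence using (EqClosure)

-- The √gl₂-crystal on a single subset T' ⊆ {1,2}.
-- {1,2} is encoded as Fin 2 : the number 1 is fzero, the number 2 is fsuc fzero.
-- The crystal element 0 is encoded as `nothing`.

Elt : Set
Elt = Subset 2

e₁ : Elt → Maybe Elt
e₁ (outside ∷ inside ∷ []) = just (inside ∷ inside ∷ [])
e₁ (inside ∷ inside ∷ [])  = just (inside ∷ outside ∷ [])
e₁ _                       = nothing

f₁ : Elt → Maybe Elt
f₁ (inside ∷ outside ∷ []) = just (inside ∷ inside ∷ [])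
f₁ (inside ∷ inside ∷ [])  = just (outside ∷ inside ∷ [])
f₁ _                       = nothing

-- sup { k : g^k(b) ≠ 0 }, computed by trying k = 1, …, N.
-- (Once g^k b = 0 all higher powers are 0, so this is the sup
--  as soon as g^(N+1) b = 0; see the fuel bounds below.)
supIter : {A : Set} → (A → Maybe A) → ℕ → A → ℕ
supIter g zero    b = 0
supIter g (suc N) b with g b
... | nothing = 0
... | just b′ = suc (supIter g N b′)

-- On a single subset at most two applications are possible.
ε₁ : Elt → ℕ
ε₁ = supIter e₁ 2

φ₁ : Elt → ℕ
φ₁ = supIter f₁ 2

-- Tensor products S₁ ⊗ (S₂ ⊗ (⋯ ⊗ Sₘ)); the empty tensor is the
-- trivial one-element crystal (e₁ = f₁ = 0).  Any bracketing gives the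
-- same crystal by associativity; we use the right-nested one.

mapM : {A B : Set} → (A → B) → Maybe A → Maybe B
mapM f nothing  = nothing
mapM f (just x) = just (f x)

mutual
  fT : {n : ℕ} → Vec Elt n → Maybe (Vec Elt n)
  fT []      = nothing
  fT (b ∷ c) = if suc (ε₁ b) ≤ᵇ φT c
               then mapM (b ∷_) (fT c)
               else mapM (_∷ c) (f₁ b)

  -- φ₁ on a tensor of n factors: sup { k : f₁^k ≠ 0 }.
  -- Each application of f₁ moves one factor one step along
  -- {1} → {1,2} → {2}, so at most 2n applications are possible.
  φT : {n : ℕ} → Vec Elt n → ℕ
  φT {n} c = supIterT (2 * n) c

  supIterT : {n : ℕ} → ℕ → Vec Elt n → ℕ
  supIterT zero    c = 0
  supIterT (suc N) c with fT c
  ... | nothing = 0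
  ... | just c′ = suc (supIterT N c′)

eT : {n : ℕ} → Vec Elt n → Maybe (Vec Elt n)
eT []      = nothing
eT (b ∷ c) = if ε₁ b ≤ᵇ φT c
             then mapM (b ∷_) (eT c)
             else mapM (_∷ c) (e₁ b)

HighestWeight : {m : ℕ} → Vec Elt m → Set
HighestWeight S = eT S ≡ nothing

entries : {m : ℕ} → Vec Elt m → List (ℕ × Elt)
entries {m} S = zip (map suc (upTo m)) (Vec.toList S)

-- The tableau tab(S).  Rows are indexed by x : Fin 2 (fzero = row 1,
-- fsuc fzero = row 2).  Row x lists m+1-j over the j with x ∈ S_j, in
-- increasing order.

tabRow : {m : ℕ} → Vec Elt m → Fin 2 → List ℕ
tabRow {m} S x =
  sort (map (λ p → suc m ∸ proj₁ p) (filter (λ p → x ∈? proj₂ p) (entries S)))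

nth : List ℕ → ℕ → Maybe ℕ
nth []       _       = nothing
nth (a ∷ as) zero    = just a
nth (a ∷ as) (suc k) = nth as k

-- T_{x,k} for column k ≥ 1 (1-indexed); nothing means (x,k) ∉ T.
entry : {m : ℕ} → Vec Elt m → Fin 2 → ℕ → Maybe ℕ
entry S x zero    = nothing
entry S x (suc k) = nth (tabRow S x) k

row1 row2 : Fin 2
row1 = fzero
row2 = fsuc fzero

-- The 1-word.  Each character carries the index j of the S_j
-- contributing it.

data Ch : Set where
  lp rp dash : Ch

chars : ℕ → Elt → List (Ch × ℕ)
chars j (inside ∷ outside ∷ [])  = (rp , j) ∷ []
chars j (outside ∷ inside ∷ [])  = (lp , j) ∷ []
chars j (inside ∷ inside ∷ [])   = (rp , j) ∷ (dash , j) ∷ (lp , j) ∷ []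
chars j (outside ∷ outside ∷ []) = []

word : {m : ℕ} → Vec Elt m → List (Ch × ℕ)
word S = concatMap (λ p → chars (proj₁ p) (proj₂ p)) (entries S)

module OneWord {m : ℕ} (S : Vec Elt m) where

  w : List (Ch × ℕ)
  w = word S

  Pos : Set
  Pos = Fin (length w)

  ch : Pos → Ch
  ch k = proj₁ (List.lookup w k)

  src : Pos → ℕ
  src k = proj₂ (List.lookup w k)

  val : Ch → ℤ
  val lp   = ℤ.+ 1
  val rp   = ℤ.- (ℤ.+ 1)
  val dash = ℤ.+ 0

  net : List Ch → ℤ
  net []       = ℤ.+ 0
  net (c ∷ cs) = val c ℤ.+ net cs

  Balanced : List Ch → Set
  Balanced cs = net cs ≡ ℤ.+ 0 × (∀ k → ℤ.+ 0 ℤ.≤ net (take k cs))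

  Matched : Pos → Pos → Set
  Matched a b = toℕ a < toℕ b × ch a ≡ lp × ch b ≡ rp
              × Balanced (map proj₁ (take (toℕ b ∸ suc (toℕ a)) (drop (suc (toℕ a)) w)))

  Unmatched : Pos → Set
  Unmatched x = ¬ (∃ λ y → Matched x y) × ¬ (∃ λ y → Matched y x)

  IsParen : Pos → Set
  IsParen x = ch x ≢ dash

  data Gen : Pos → Pos → Set where
    pair : ∀ {a b x y} → Matched a b
         → toℕ a ≤ toℕ x → toℕ x ≤ toℕ b → toℕ a ≤ toℕ y → toℕ y ≤ toℕ b
         → Gen x y
    -- characters contributed by the same S_j (i.e. the three
    -- characters of a ")−(")
    same : ∀ {x y} → src x ≡ src y → Gen x y

  SameClass : Pos → Pos → Set
  SameClass = EqClosure Gen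

  -- the class C (given by a representative) starts in position i
  StartsAt : Pos → ℕ → Set
  StartsAt c i = ∃ λ x → SameClass c x × IsParen x × src x ≡ i
               × (∀ y → SameClass c y → IsParen y → toℕ x ≤ toℕ y)

  NullForm : Pos → Set
  NullForm c = ∀ x → SameClass c x → IsParen x → ¬ Unmatched x

  RightForm : Pos → Set
  RightForm c = (∀ x → SameClass c x → ch x ≡ lp → ¬ Unmatched x)
              × (∃ λ x → SameClass c x × IsParen x
                    × (∀ y → SameClass c y → IsParen y → toℕ x ≤ toℕ y)
                    × ch x ≡ rp × Unmatched x)

  IsLast : Pos → Set
  IsLast c = suc (toℕ c) ≡ length w

EndsWithNullFormAt : {m : ℕ} → Vec Elt m → ℕ → Set
EndsWithNullFormAt S i = ∃ λ c → IsLast c × NullForm c × StartsAt c i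
  where open OneWord S

EndsWithRightForm : {m : ℕ} → Vec Elt m → Set
EndsWithRightForm S = ∃ λ c → IsLast c × RightForm c
  where open OneWord S

countFrom : {m : ℕ} → Vec Elt m → ℕ → Fin 2 → ℕ
countFrom S i x = length (filter (λ p → (i ≤? proj₁ p) ×-dec (x ∈? proj₂ p)) (entries S))

StopCond : {m : ℕ} → Vec Elt m → ℕ → Set
StopCond S k = entry S row1 (suc k) ≡ nothing
             ⊎ (∃ λ a → ∃ λ b → entry S row2 k ≡ just a × entry S row1 (suc k) ≡ just b × a < b)

-- Read the 1-word as a walk: "(" steps up, ")" steps down, and H t is the height after t
-- characters. From the first character of S_j on, the walk meets one ")" for every later entry
-- containing 1 and one "(" for every later entry containing 2, so H(end) − H(start of S_j) is the
-- number of entries S_j, …, S_m containing 2 minus the number containing 1. Row x of T lists the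
-- m+1−j with x ∈ S_j increasingly, hence T_{2,k} = m+1−j for the j with 2 ∈ S_j at which that suffix
-- count of 2s reaches k, and T_{1,k+1} ≤ T_{2,k} exactly when the walk ends strictly below its height
-- at S_j.
--
-- A position splitting neither an S_j nor a matched pair separates whole classes, and every prefix
-- or suffix minimum of the walk at the start of some S_j is such a cut. The last class reaches the
-- end, so no cut lies between its first parenthesis x and the end: the walk ends strictly below
-- every later start of an S_j, and (as the class has no unmatched "(") never drops below its final
-- height after x. For a right form x is an unmatched ")", a prefix minimum lying above the final
-- height, so the walk ends below every start of an S_j, including position 0; this is (b). For a
-- null form x is the "(" starting S_i, the walk stays at or above H(x) after x and ends there; this
-- gives the equal counts of (a), and the entries after S_i give T_{1,k+1} ≤ T_{2,k} for k < r.

module Submission where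

open import Defs
open import Data.Nat using (ℕ; zero; suc; _+_; _∸_; _⊓_; _≤_; _<_; _≟_; _≤?_; _<?_; z≤n; s≤s)
open import Data.Nat.Properties
  using (≤-refl; ≤-reflexive; ≤-trans; ≤-antisym; ≤-pred; <⇒≤; <⇒≱; ≰⇒>; ≮⇒≥; <-trans; <-≤-trans; ≤-<-trans;
         ≤∧≢⇒<; m≤n⇒m<n∨m≡n; n<1+n; n≤1+n; n≮0; n≤0⇒n≡0; suc-injective; m≤m+n; +-monoʳ-≤; +-∸-assoc;
         m+[n∸m]≡n; ∸-monoˡ-≤; ∸-monoʳ-≤; ∸-monoʳ-<; m≤n⇒m⊓n≡m; m⊓n≤n; ≤-decTotalOrder; ≤-totalOrder)
open import Data.Fin using (Fin; toℕ; fromℕ<) renaming (zero to fzero; suc to fsuc)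
open import Data.Fin.Properties using (toℕ-fromℕ<; toℕ<n; toℕ-injective)
open import Data.Fin.Subset using (inside; outside; _∈_)
open import Data.Fin.Subset.Properties using (_∈?_)
open import Data.Vec using (Vec; []; _∷_; here; there; toList)
open import Data.List using (List; []; _∷_; _++_; length; lookup; map; filter; take; drop; zip; applyUpTo; concatMap)
open import Data.List.Properties
  using (filter-accept; filter-reject; filter-all; filter-none; filter-≐; filter-++; map-++; map-upTo; length-map;
         take-map; take-take; take-all; take++drop≡id)
open import Data.List.Membership.Propositional using (find; lose) renaming (_∈_ to _∈ₗ_)
open import Data.List.Membership.Propositional.Properties using (∈-concatMap⁺; ∈-concatMap⁻)
open import Data.List.Relation.Unary.All as All using (All; []; _∷_)
open import Data.List.Relation.Unary.AllPairs using (AllPairs; []; _∷_)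
open import Data.List.Relation.Unary.Any using (here; there)
open import Data.List.Relation.Unary.Linked using (Linked; []; [-]; _∷_; tail)
open import Data.List.Relation.Unary.Linked.Properties using (Linked⇒All)
open import Data.List.Relation.Unary.Sorted.TotalOrder ≤-totalOrder using (Sorted)
open import Data.List.Relation.Binary.Sublist.Propositional using (⊆-refl)
open import Data.List.Relation.Binary.Sublist.Propositional.Properties using (filter⁺; length-mono-≤)
open import Data.List.Relation.Binary.Permutation.Propositional.Properties using (filter-↭; ↭-length)
open import Data.List.Sort.InsertionSort.Properties ≤-decTotalOrder using (sort-↭; sort-↗)
import Data.Integer as ℤ
open ℤ using (ℤ; +_; -_; 0ℤ; 1ℤ) renaming (_+_ to _+ℤ_; _≤_ to _≤ℤ_; _<_ to _<ℤ_; suc to sucℤ)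
import Data.Integer.Properties as ℤₚ
open import Data.Integer.Tactic.RingSolver using (solve-∀)
open import Algebra.Bundles using (AbelianGroup)
open import Algebra.Properties.Group (AbelianGroup.group ℤₚ.+-0-abelianGroup) using (∙-cancelˡ)
open import Data.Maybe using (just; nothing)
open import Data.Maybe.Properties using (just-injective)
open import Data.Product using (_×_; _,_; proj₁; proj₂; ∃; ∃₂)
open import Data.Sum using (_⊎_; inj₁; inj₂)
open import Data.Unit using (⊤; tt)
open import Data.Empty using (⊥; ⊥-elim)
open import Function using (_∘_)
open import Relation.Nullary using (¬_; Dec; yes; no)
open import Relation.Nullary.Decidable using (_×-dec_)
open import Relation.Unary using (Decidable)
open import Relation.Binary.PropositionalEquality hiding (J)
open import Relation.Binary.Construct.Closure.ReflexiveTransitive using (ε; _◅_; _◅◅_)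
open import Relation.Binary.Construct.Closure.Symmetric using (fwd; bwd)

Entry : Set
Entry = ℕ × Elt

-- countFrom S is countFromList (entries S), definitionally.
countFromList : List Entry → ℕ → Fin 2 → ℕ
countFromList E i x = length (filter (λ p → (i ≤? proj₁ p) ×-dec (x ∈? proj₂ p)) E)

Ascending : List Entry → Set
Ascending = AllPairs (λ p q → proj₁ p < proj₁ q)

module _ {i j : ℕ} {x : Fin 2} {s : Elt} (E : List Entry) where

  countFrom-accept : i ≤ j → x ∈ s → countFromList ((j , s) ∷ E) i x ≡ suc (countFromList E i x)
  countFrom-accept i≤j x∈s = cong length (filter-accept (λ p → (i ≤? proj₁ p) ×-dec (x ∈? proj₂ p)) (i≤j , x∈s))

  countFrom-below : j < i → countFromList ((j , s) ∷ E) i x ≡ countFromList E i x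
  countFrom-below j<i = cong length (filter-reject (λ p → (i ≤? proj₁ p) ×-dec (x ∈? proj₂ p)) (<⇒≱ j<i ∘ proj₁))

  countFrom-∉ : ¬ x ∈ s → countFromList ((j , s) ∷ E) i x ≡ countFromList E i x
  countFrom-∉ x∉s = cong length (filter-reject (λ p → (i ≤? proj₁ p) ×-dec (x ∈? proj₂ p)) (x∉s ∘ proj₂))

countFrom-antitone : ∀ {i i′ x} (E : List Entry) → i ≤ i′ → countFromList E i′ x ≤ countFromList E i x
countFrom-antitone {i} {i′} {x} E i≤i′ = length-mono-≤
  (filter⁺ (λ p → (i′ ≤? proj₁ p) ×-dec (x ∈? proj₂ p)) (λ p → (i ≤? proj₁ p) ×-dec (x ∈? proj₂ p))
           (λ { refl (i′≤j , x∈s) → ≤-trans i≤i′ i′≤j , x∈s }) (⊆-refl {x = E}))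

countFrom-lowerBound : ∀ {i x} (E : List Entry) → All (λ p → i ≤ proj₁ p) E →
                       countFromList E i x ≡ countFromList E 0 x
countFrom-lowerBound [] [] = refl
countFrom-lowerBound {i} {x} ((j , s) ∷ E) (i≤j ∷ bound) = by-cases (x ∈? s)
  where
  open ≡-Reasoning
  by-cases : Dec (x ∈ s) → countFromList ((j , s) ∷ E) i x ≡ countFromList ((j , s) ∷ E) 0 x
  by-cases (yes x∈s) = begin
    countFromList ((j , s) ∷ E) i x  ≡⟨ countFrom-accept E i≤j x∈s ⟩
    suc (countFromList E i x)        ≡⟨ cong suc (countFrom-lowerBound E bound) ⟩
    suc (countFromList E 0 x)        ≡⟨ countFrom-accept E z≤n x∈s ⟨
    countFromList ((j , s) ∷ E) 0 x  ∎
  by-cases (no x∉s) = begin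
    countFromList ((j , s) ∷ E) i x  ≡⟨ countFrom-∉ E x∉s ⟩
    countFromList E i x              ≡⟨ countFrom-lowerBound E bound ⟩
    countFromList E 0 x              ≡⟨ countFrom-∉ E x∉s ⟨
    countFromList ((j , s) ∷ E) 0 x  ∎

countFrom-step : ∀ {j s x} (E : List Entry) → Ascending E → (j , s) ∈ₗ E → x ∈ s →
                 countFromList E j x ≡ suc (countFromList E (suc j) x)
countFrom-step {j} {s} {x} ((j , s) ∷ E) (later ∷ _) (here refl) x∈s = begin
  countFromList ((j , s) ∷ E) j x              ≡⟨ countFrom-accept E ≤-refl x∈s ⟩
  suc (countFromList E j x)                    ≡⟨ cong suc (countFrom-lowerBound E (All.map <⇒≤ later)) ⟩
  suc (countFromList E 0 x)                    ≡⟨ cong suc (countFrom-lowerBound E later) ⟨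
  suc (countFromList E (suc j) x)              ≡⟨ cong suc (countFrom-below E (n<1+n j)) ⟨
  suc (countFromList ((j , s) ∷ E) (suc j) x)  ∎
  where open ≡-Reasoning
countFrom-step {j} {s} {x} ((j′ , s′) ∷ E) (later ∷ asc) (there j∈E) x∈s = begin
  countFromList ((j′ , s′) ∷ E) j x              ≡⟨ countFrom-below E j′<j ⟩
  countFromList E j x                            ≡⟨ countFrom-step E asc j∈E x∈s ⟩
  suc (countFromList E (suc j) x)                ≡⟨ cong suc (countFrom-below E (≤-trans j′<j (n≤1+n j))) ⟨
  suc (countFromList ((j′ , s′) ∷ E) (suc j) x)  ∎
  where
  open ≡-Reasoning
  j′<j : j′ < j
  j′<j = All.lookup later j∈E

countFrom-find : ∀ {x k} (E : List Entry) → Ascending E → 1 ≤ k → k ≤ countFromList E 0 x →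
                 ∃₂ λ j s → (j , s) ∈ₗ E × x ∈ s × countFromList E j x ≡ k
countFrom-find [] _ 1≤k k≤0 = ⊥-elim (<⇒≱ 1≤k k≤0)
countFrom-find {x} {k} ((j , s) ∷ E) (later ∷ asc) 1≤k k≤count = by-cases (x ∈? s)
  where
  Found : List Entry → Set
  Found E′ = ∃₂ λ j′ s′ → (j′ , s′) ∈ₗ E′ × x ∈ s′ × countFromList E′ j′ x ≡ k

  inTail : Found E → Found ((j , s) ∷ E)
  inTail (j′ , s′ , j′∈E , x∈s′ , count≡k) =
    j′ , s′ , there j′∈E , x∈s′ , trans (countFrom-below E (All.lookup later j′∈E)) count≡k

  by-cases : Dec (x ∈ s) → Found ((j , s) ∷ E)
  by-cases (no x∉s) = inTail (countFrom-find E asc 1≤k (subst (k ≤_) (countFrom-∉ E x∉s) k≤count))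
  by-cases (yes x∈s) with k ≤? countFromList E 0 x
  ... | yes k≤tail = inTail (countFrom-find E asc 1≤k k≤tail)
  ... | no k≰tail = j , s , here refl , x∈s , (begin
    countFromList ((j , s) ∷ E) j x  ≡⟨ countFrom-accept E ≤-refl x∈s ⟩
    suc (countFromList E j x)        ≡⟨ cong suc (countFrom-lowerBound E (All.map <⇒≤ later)) ⟩
    suc (countFromList E 0 x)        ≡⟨ ≤-antisym (≰⇒> k≰tail) (subst (k ≤_) (countFrom-accept E z≤n x∈s) k≤count) ⟩
    k                                ∎)
    where open ≡-Reasoning

∈-zip-applyUpTo : ∀ (f : ℕ → ℕ) n (xs : List Elt) {j s} →
                  (j , s) ∈ₗ zip (applyUpTo f n) xs → ∃ λ i → i < n × j ≡ f i
∈-zip-applyUpTo f (suc n) (_ ∷ _) (here refl) = 0 , s≤s z≤n , refl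
∈-zip-applyUpTo f (suc n) (_ ∷ xs) (there j∈) with ∈-zip-applyUpTo (f ∘ suc) n xs j∈
... | i , i<n , refl = suc i , s≤s i<n , refl

zip-applyUpTo-ascending : ∀ (f : ℕ → ℕ) n (xs : List Elt) → (∀ {i i′} → i < i′ → f i < f i′) →
                          Ascending (zip (applyUpTo f n) xs)
zip-applyUpTo-ascending f zero xs f-mono = []
zip-applyUpTo-ascending f (suc n) [] f-mono = []
zip-applyUpTo-ascending f (suc n) (_ ∷ xs) f-mono =
  All.tabulate later ∷ zip-applyUpTo-ascending (f ∘ suc) n xs (f-mono ∘ s≤s)
  where
  later : ∀ {e} → e ∈ₗ zip (applyUpTo (f ∘ suc) n) xs → f 0 < proj₁ e
  later e∈ with ∈-zip-applyUpTo (f ∘ suc) n xs e∈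
  ... | i , _ , refl = f-mono (s≤s z≤n)

module _ {m : ℕ} (S : Vec Elt m) where

  entries≡zip : entries S ≡ zip (applyUpTo suc m) (toList S)
  entries≡zip = cong (λ js → zip js (toList S)) (map-upTo suc m)

  entries-bounded : ∀ {j s} → (j , s) ∈ₗ entries S → j ≤ m
  entries-bounded j∈ with ∈-zip-applyUpTo suc m (toList S) (subst (_ ∈ₗ_) entries≡zip j∈)
  ... | i , i<m , refl = i<m

  entries-ascending : Ascending (entries S)
  entries-ascending = subst Ascending (sym entries≡zip) (zip-applyUpTo-ascending suc m (toList S) s≤s)

countAtMost : ℕ → List ℕ → ℕ
countAtMost v L = length (filter (_≤? v) L)

nth-∈ : ∀ {L k b} → nth L k ≡ just b → b ∈ₗ L
nth-∈ {_ ∷ _} {zero} refl = here refl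
nth-∈ {_ ∷ L} {suc k} eq = there (nth-∈ {L} {k} eq)

head-≤-tail : ∀ {a L} → Sorted (a ∷ L) → All (a ≤_) L
head-≤-tail [-] = []
head-≤-tail (a≤b ∷ sorted) = Linked⇒All ≤-trans a≤b sorted

head-≤-nth : ∀ {a L k b} → Sorted (a ∷ L) → nth (a ∷ L) k ≡ just b → a ≤ b
head-≤-nth {a} {L} {k} sorted eq = All.lookup (≤-refl ∷ head-≤-tail sorted) (nth-∈ {a ∷ L} {k} eq)

countAtMost-none : ∀ {v L} → All (λ a → v < a) L → countAtMost v L ≡ 0
countAtMost-none {v} above = cong length (filter-none (_≤? v) (All.map <⇒≱ above))

module _ {v a : ℕ} {L : List ℕ} where

  countAtMost-accept : a ≤ v → countAtMost v (a ∷ L) ≡ suc (countAtMost v L)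
  countAtMost-accept a≤v = cong length (filter-accept (_≤? v) a≤v)

  countAtMost-reject : ¬ a ≤ v → countAtMost v (a ∷ L) ≡ countAtMost v L
  countAtMost-reject a≰v = cong length (filter-reject (_≤? v) a≰v)

nth-below-countAtMost : ∀ {v} L k → Sorted L → k < countAtMost v L → ∃ λ b → nth L k ≡ just b × b ≤ v
nth-below-countAtMost {v} (a ∷ L) k sorted k<count = by-cases (a ≤? v) k k<count
  where
  by-cases : Dec (a ≤ v) → ∀ k → k < countAtMost v (a ∷ L) → ∃ λ b → nth (a ∷ L) k ≡ just b × b ≤ v
  by-cases (yes a≤v) zero _ = a , refl , a≤v
  by-cases (yes a≤v) (suc k) k<count =
    nth-below-countAtMost L k (tail sorted) (≤-pred (subst (suc k <_) (countAtMost-accept a≤v) k<count))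
  by-cases (no a≰v) k k<count = ⊥-elim (n≮0 (subst (k <_) count≡0 k<count))
    where
    count≡0 : countAtMost v (a ∷ L) ≡ 0
    count≡0 = trans (countAtMost-reject a≰v) (countAtMost-none (All.map (<-≤-trans (≰⇒> a≰v)) (head-≤-tail sorted)))

nth-from-countAtMost : ∀ {v} L k → Sorted L → countAtMost v L ≤ k →
                       nth L k ≡ nothing ⊎ ∃ λ b → nth L k ≡ just b × v < b
nth-from-countAtMost [] k _ _ = inj₁ refl
nth-from-countAtMost {v} (a ∷ L) k sorted count≤k = by-cases (a ≤? v) k count≤k
  where
  by-cases : Dec (a ≤ v) → ∀ k → countAtMost v (a ∷ L) ≤ k →
             nth (a ∷ L) k ≡ nothing ⊎ ∃ λ b → nth (a ∷ L) k ≡ just b × v < b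
  by-cases (yes a≤v) zero count≤k = ⊥-elim (n≮0 (subst (_≤ 0) (countAtMost-accept a≤v) count≤k))
  by-cases (yes a≤v) (suc k) count≤k =
    nth-from-countAtMost L k (tail sorted) (≤-pred (subst (_≤ suc k) (countAtMost-accept a≤v) count≤k))
  by-cases (no a≰v) k _ with nth (a ∷ L) k in eq
  ... | nothing = inj₁ refl
  ... | just b = inj₂ (b , refl , <-≤-trans (≰⇒> a≰v) (head-≤-nth {k = k} sorted eq))

-- tabRow S x is sort (rowValues m (entries S) x), definitionally.
rowValues : ℕ → List Entry → Fin 2 → List ℕ
rowValues m E x = map (λ p → suc m ∸ proj₁ p) (filter (λ p → x ∈? proj₂ p) E)

module _ {m j : ℕ} {x : Fin 2} {s : Elt} (E : List Entry) where

  rowValues-accept : x ∈ s → rowValues m ((j , s) ∷ E) x ≡ suc m ∸ j ∷ rowValues m E x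
  rowValues-accept x∈s = cong (map (λ p → suc m ∸ proj₁ p)) (filter-accept (λ p → x ∈? proj₂ p) x∈s)

  rowValues-reject : ¬ x ∈ s → rowValues m ((j , s) ∷ E) x ≡ rowValues m E x
  rowValues-reject x∉s = cong (map (λ p → suc m ∸ proj₁ p)) (filter-reject (λ p → x ∈? proj₂ p) x∉s)

countAtMost-rowValues : ∀ {m j x} (E : List Entry) → j ≤ suc m →
                        countAtMost (suc m ∸ j) (rowValues m E x) ≡ countFromList E j x
countAtMost-rowValues [] _ = refl
countAtMost-rowValues {m} {j} {x} ((j′ , s) ∷ E) j≤1+m = by-cases (x ∈? s)
  where
  open ≡-Reasoning
  v : ℕ
  v = suc m ∸ j
  ih : countAtMost v (rowValues m E x) ≡ countFromList E j x
  ih = countAtMost-rowValues E j≤1+m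
  by-cases : Dec (x ∈ s) → countAtMost v (rowValues m ((j′ , s) ∷ E) x) ≡ countFromList ((j′ , s) ∷ E) j x
  by-cases (no x∉s) = begin
    countAtMost v (rowValues m ((j′ , s) ∷ E) x)  ≡⟨ cong (countAtMost v) (rowValues-reject E x∉s) ⟩
    countAtMost v (rowValues m E x)               ≡⟨ ih ⟩
    countFromList E j x                           ≡⟨ countFrom-∉ E x∉s ⟨
    countFromList ((j′ , s) ∷ E) j x              ∎
  by-cases (yes x∈s) with j ≤? j′
  ... | yes j≤j′ = begin
    countAtMost v (rowValues m ((j′ , s) ∷ E) x)  ≡⟨ cong (countAtMost v) (rowValues-accept E x∈s) ⟩
    countAtMost v (suc m ∸ j′ ∷ rowValues m E x)  ≡⟨ countAtMost-accept (∸-monoʳ-≤ (suc m) j≤j′) ⟩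
    suc (countAtMost v (rowValues m E x))         ≡⟨ cong suc ih ⟩
    suc (countFromList E j x)                     ≡⟨ countFrom-accept E j≤j′ x∈s ⟨
    countFromList ((j′ , s) ∷ E) j x              ∎
  ... | no j≰j′ = begin
    countAtMost v (rowValues m ((j′ , s) ∷ E) x)  ≡⟨ cong (countAtMost v) (rowValues-accept E x∈s) ⟩
    countAtMost v (suc m ∸ j′ ∷ rowValues m E x)  ≡⟨ countAtMost-reject (<⇒≱ (∸-monoʳ-< (≰⇒> j≰j′) j≤1+m)) ⟩
    countAtMost v (rowValues m E x)               ≡⟨ ih ⟩
    countFromList E j x                           ≡⟨ countFrom-below E (≰⇒> j≰j′) ⟨
    countFromList ((j′ , s) ∷ E) j x              ∎

module _ {m : ℕ} (S : Vec Elt m) where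

  tabRow-sorted : ∀ x → Sorted (tabRow S x)
  tabRow-sorted x = sort-↗ (rowValues m (entries S) x)

  tabRow-countAtMost : ∀ {j x} → j ≤ suc m → countAtMost (suc m ∸ j) (tabRow S x) ≡ countFrom S j x
  tabRow-countAtMost {j} {x} j≤1+m = trans
    (↭-length (filter-↭ (_≤? suc m ∸ j) (sort-↭ (rowValues m (entries S) x))))
    (countAtMost-rowValues (entries S) j≤1+m)

  tabRow-length : ∀ x → length (tabRow S x) ≡ countFrom S 0 x
  tabRow-length x = begin
    length (tabRow S x)                                          ≡⟨ ↭-length (sort-↭ (rowValues m (entries S) x)) ⟩
    length (rowValues m (entries S) x)                           ≡⟨ length-map _ (filter (λ p → x ∈? proj₂ p) (entries S)) ⟩
    length (filter (λ p → x ∈? proj₂ p) (entries S))             ≡⟨ cong length (filter-≐ _ _ ((z≤n ,_) , proj₂) (entries S)) ⟩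
    countFrom S 0 x                                              ∎
    where open ≡-Reasoning

  count>⇒entry≤ : ∀ {j x} k → j ≤ suc m → k < countFrom S j x →
                  ∃ λ b → entry S x (suc k) ≡ just b × b ≤ suc m ∸ j
  count>⇒entry≤ {x = x} k j≤1+m k<count =
    nth-below-countAtMost (tabRow S x) k (tabRow-sorted x) (subst (k <_) (sym (tabRow-countAtMost j≤1+m)) k<count)

  count≤⇒entry> : ∀ {j x} k → j ≤ suc m → countFrom S j x ≤ k →
                  entry S x (suc k) ≡ nothing ⊎ ∃ λ b → entry S x (suc k) ≡ just b × suc m ∸ j < b
  count≤⇒entry> {x = x} k j≤1+m count≤k =
    nth-from-countAtMost (tabRow S x) k (tabRow-sorted x) (subst (_≤ k) (sym (tabRow-countAtMost j≤1+m)) count≤k)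

  entry-of-count : ∀ {j s x} k → (j , s) ∈ₗ entries S → x ∈ s → countFrom S j x ≡ suc k →
                   entry S x (suc k) ≡ just (suc m ∸ j)
  entry-of-count {j} {s} {x} k j∈S x∈s count≡1+k =
    pin (count>⇒entry≤ k (≤-trans j≤m (n≤1+n m)) (subst (k <_) (sym count≡1+k) ≤-refl))
        (count≤⇒entry> k (s≤s j≤m) next≤k)
    where
    j≤m : j ≤ m
    j≤m = entries-bounded S j∈S
    next≤k : countFrom S (suc j) x ≤ k
    next≤k = ≤-reflexive (suc-injective (trans (sym (countFrom-step (entries S) (entries-ascending S) j∈S x∈s)) count≡1+k))
    pin : (∃ λ b → entry S x (suc k) ≡ just b × b ≤ suc m ∸ j) →
          (entry S x (suc k) ≡ nothing ⊎ ∃ λ b → entry S x (suc k) ≡ just b × m ∸ j < b) →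
          entry S x (suc k) ≡ just (suc m ∸ j)
    pin (b , eq , b≤) (inj₁ none) with () ← trans (sym eq) none
    pin (b , eq , b≤) (inj₂ (b′ , eq′ , m∸j<b′)) = trans eq (cong just (≤-antisym b≤ m+1∸j≤b))
      where
      m+1∸j≤b : suc m ∸ j ≤ b
      m+1∸j≤b = subst₂ _≤_ (sym (+-∸-assoc 1 j≤m)) (just-injective (trans (sym eq′) eq)) m∸j<b′

  Dominated : ℕ → Set
  Dominated k = ∃ λ a → ∃ λ b → entry S row2 k ≡ just a × entry S row1 (suc k) ≡ just b × b ≤ a

  dominated⇒¬StopCond : ∀ {k} → Dominated k → ¬ StopCond S k
  dominated⇒¬StopCond (_ , _ , _ , row1-entry , _) (inj₁ none) with () ← trans (sym row1-entry) none
  dominated⇒¬StopCond (a , b , row2-entry , row1-entry , b≤a) (inj₂ (a′ , b′ , row2-entry′ , row1-entry′ , a′<b′)) =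
    <⇒≱ (subst₂ _<_ (just-injective (trans (sym row2-entry′) row2-entry))
                    (just-injective (trans (sym row1-entry′) row1-entry)) a′<b′) b≤a

  dominated-column : ∀ {j s k} → (j , s) ∈ₗ entries S → row2 ∈ s → countFrom S j row2 ≡ suc k →
                     countFrom S j row2 < countFrom S j row1 → Dominated (suc k)
  dominated-column {j} {s} {k} j∈S row2∈s count≡1+k gap with
    count>⇒entry≤ (suc k) (≤-trans (entries-bounded S j∈S) (n≤1+n m)) (subst (_< countFrom S j row1) count≡1+k gap)
  ... | b , row1-entry , b≤ = suc m ∸ j , b , entry-of-count k j∈S row2∈s count≡1+k , row1-entry , b≤

Char : Set
Char = Ch × ℕ

-- word S is oneWord (entries S), definitionally.
oneWord : List Entry → List Char
oneWord = concatMap (λ p → chars (proj₁ p) (proj₂ p))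

data Adjacent (a b : Char) : Set where
  across  : proj₂ a < proj₂ b → proj₁ a ≢ dash → proj₁ b ≢ dash → Adjacent a b
  rp-dash : proj₁ a ≡ rp → proj₁ b ≡ dash → proj₂ a ≡ proj₂ b → Adjacent a b
  dash-lp : proj₁ a ≡ dash → proj₁ b ≡ lp → proj₂ a ≡ proj₂ b → Adjacent a b

FirstFrom : ℕ → List Char → Set
FirstFrom j [] = ⊤
FirstFrom j ((c , j′) ∷ _) = c ≢ dash × j ≤ j′

oneWord-first : ∀ {j} E → All (λ p → j ≤ proj₁ p) E → FirstFrom j (oneWord E)
oneWord-first [] [] = tt
oneWord-first ((_ , inside ∷ outside ∷ []) ∷ _) (j≤ ∷ _) = (λ ()) , j≤
oneWord-first ((_ , outside ∷ inside ∷ []) ∷ _) (j≤ ∷ _) = (λ ()) , j≤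
oneWord-first ((_ , inside ∷ inside ∷ []) ∷ _) (j≤ ∷ _) = (λ ()) , j≤
oneWord-first ((_ , outside ∷ outside ∷ []) ∷ E) (_ ∷ bound) = oneWord-first E bound

linked-∷ : ∀ {c j cs} → c ≢ dash → FirstFrom (suc j) cs → Linked Adjacent cs → Linked Adjacent ((c , j) ∷ cs)
linked-∷ {cs = []} _ _ _ = [-]
linked-∷ {cs = _ ∷ _} c≢dash (c′≢dash , j<j′) linked = across j<j′ c≢dash c′≢dash ∷ linked

oneWord-linked : ∀ E → Ascending E → Linked Adjacent (oneWord E)
oneWord-linked [] [] = []
oneWord-linked ((j , inside ∷ outside ∷ []) ∷ E) (later ∷ asc) =
  linked-∷ (λ ()) (oneWord-first E later) (oneWord-linked E asc)
oneWord-linked ((j , outside ∷ inside ∷ []) ∷ E) (later ∷ asc) =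
  linked-∷ (λ ()) (oneWord-first E later) (oneWord-linked E asc)
oneWord-linked ((j , inside ∷ inside ∷ []) ∷ E) (later ∷ asc) =
  rp-dash refl refl refl ∷ dash-lp refl refl refl ∷ linked-∷ (λ ()) (oneWord-first E later) (oneWord-linked E asc)
oneWord-linked ((j , outside ∷ outside ∷ []) ∷ E) (later ∷ asc) = oneWord-linked E asc

∈-chars : ∀ {c j j′ s} → (c , j) ∈ₗ chars j′ s → j ≡ j′ × (c ≡ lp → row2 ∈ s)
∈-chars {s = inside ∷ outside ∷ []} (here refl) = refl , λ ()
∈-chars {s = outside ∷ inside ∷ []} (here refl) = refl , λ _ → there here
∈-chars {s = inside ∷ inside ∷ []} (here refl) = refl , λ ()
∈-chars {s = inside ∷ inside ∷ []} (there (here refl)) = refl , λ ()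
∈-chars {s = inside ∷ inside ∷ []} (there (there (here refl))) = refl , λ _ → there here

lp∈chars : ∀ {j s} → row2 ∈ s → (lp , j) ∈ₗ chars j s
lp∈chars {s = outside ∷ inside ∷ []} _ = here refl
lp∈chars {s = inside ∷ inside ∷ []} _ = there (there (here refl))
lp∈chars {s = _ ∷ outside ∷ []} (there ())

∈-oneWord⁻ : ∀ {c j} E → (c , j) ∈ₗ oneWord E → ∃ λ s → (j , s) ∈ₗ E × (c ≡ lp → row2 ∈ s)
∈-oneWord⁻ E c∈ with find (∈-concatMap⁻ (λ p → chars (proj₁ p) (proj₂ p)) {xs = E} c∈)
... | (j′ , s) , e∈E , c∈chars with ∈-chars {s = s} c∈chars
...   | refl , lp⇒row2 = s , e∈E , lp⇒row2

lp∈oneWord : ∀ {j s} E → (j , s) ∈ₗ E → row2 ∈ s → (lp , j) ∈ₗ oneWord E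
lp∈oneWord E e∈E row2∈s = ∈-concatMap⁺ (λ p → chars (proj₁ p) (proj₂ p)) {xs = E} (lose e∈E (lp∈chars row2∈s))

-- Total indexing: positions beyond the end read as a dash.
at : List Char → ℕ → Char
at [] _ = dash , 0
at (c ∷ _) zero = c
at (_ ∷ cs) (suc t) = at cs t

lookup≡at : ∀ (cs : List Char) (k : Fin (length cs)) → lookup cs k ≡ at cs (toℕ k)
lookup≡at (_ ∷ _) fzero = refl
lookup≡at (_ ∷ cs) (fsuc k) = lookup≡at cs k

at-∈ : ∀ (cs : List Char) {t} → t < length cs → at cs t ∈ₗ cs
at-∈ (_ ∷ _) {zero} _ = here refl
at-∈ (_ ∷ cs) {suc t} (s≤s t<len) = there (at-∈ cs t<len)

∈⇒at : ∀ (cs : List Char) {c} → c ∈ₗ cs → ∃ λ t → t < length cs × at cs t ≡ c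
∈⇒at (_ ∷ _) (here refl) = 0 , s≤s z≤n , refl
∈⇒at (_ ∷ cs) (there c∈) with ∈⇒at cs c∈
... | t , t<len , eq = suc t , s≤s t<len , eq

linked-at : ∀ {R : Char → Char → Set} {cs} → Linked R cs → ∀ {t} → suc t < length cs → R (at cs t) (at cs (suc t))
linked-at [-] {zero} (s≤s ())
linked-at (r ∷ _) {zero} _ = r
linked-at (_ ∷ linked) {suc t} (s≤s t+1<len) = linked-at linked t+1<len

first-paren : ∀ {j} (cs : List Char) → FirstFrom j cs → 0 < length cs → proj₁ (at cs 0) ≢ dash
first-paren (_ ∷ _) (c≢dash , _) _ = c≢dash

i<sucℤi : ∀ i → i <ℤ sucℤ i
i<sucℤi i = ℤₚ.suc[i]≤j⇒i<j ℤₚ.≤-refl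

+-cancel-≡0 : ∀ a {x} → a +ℤ x ≡ a → x ≡ 0ℤ
+-cancel-≡0 a {x} a+x≡a = ∙-cancelˡ a x 0ℤ (trans a+x≡a (sym (ℤₚ.+-identityʳ a)))

≤+⇒0≤ : ∀ a {x} → a ≤ℤ a +ℤ x → 0ℤ ≤ℤ x
≤+⇒0≤ a {x} a≤a+x = subst₂ _≤ℤ_ (ℤₚ.+-inverseˡ a) (sym (regroup a x)) (ℤₚ.+-monoʳ-≤ (- a) a≤a+x)
  where
  regroup : ∀ a x → x ≡ - a +ℤ (a +ℤ x)
  regroup = solve-∀

+-cancelˡ-pos : ∀ a {c₁ c₂} → a +ℤ + c₁ ≡ a +ℤ + c₂ → c₁ ≡ c₂
+-cancelˡ-pos a {c₁} {c₂} eq = ℤₚ.+-injective (∙-cancelˡ a (+ c₁) (+ c₂) eq)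

count-gap : ∀ {a b c₁ c₂} → a +ℤ + c₁ ≡ b +ℤ + c₂ → a <ℤ b → c₂ < c₁
count-gap {a} {b} {c₁} {c₂} eq a<b with c₂ <? c₁
... | yes c₂<c₁ = c₂<c₁
... | no c₂≮c₁ = ⊥-elim (ℤₚ.<-irrefl eq (ℤₚ.+-mono-<-≤ a<b (ℤ.+≤+ (≮⇒≥ c₂≮c₁))))

0≤⇒≤+ : ∀ a {x} → 0ℤ ≤ℤ x → a ≤ℤ a +ℤ x
0≤⇒≤+ a 0≤x = subst (_≤ℤ a +ℤ _) (ℤₚ.+-identityʳ a) (ℤₚ.+-monoʳ-≤ a 0≤x)

lastWitness : ∀ {P : ℕ → Set} → Decidable P → ∀ {s y} → s < y → P s →
              ∃ λ t → s ≤ t × t < y × P t × (∀ u → t < u → u < y → ¬ P u)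
lastWitness P? {s} {suc y} s<y+1 Ps with P? y
... | yes Py = y , ≤-pred s<y+1 , n<1+n y , Py , λ u y<u u<y+1 → ⊥-elim (<⇒≱ y<u (≤-pred u<y+1))
... | no ¬Py with m≤n⇒m<n∨m≡n (≤-pred s<y+1)
...   | inj₂ refl = ⊥-elim (¬Py Ps)
...   | inj₁ s<y with lastWitness P? s<y Ps
...     | t , s≤t , t<y , Pt , none-after = t , s≤t , <-trans t<y (n<1+n y) , Pt , none-after′
  where
  none-after′ : ∀ u → t < u → u < suc y → ¬ _
  none-after′ u t<u u<y+1 with m≤n⇒m<n∨m≡n (≤-pred u<y+1)
  ... | inj₁ u<y = none-after u t<u u<y
  ... | inj₂ refl = ¬Py

firstBelow : ∀ {P : ℕ → Set} → Decidable P → ∀ n →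
             (∃ λ t → t < n × P t × (∀ u → u < t → ¬ P u)) ⊎ (∀ u → u < n → ¬ P u)
firstBelow P? zero = inj₂ (λ _ ())
firstBelow P? (suc n) with firstBelow P? n
... | inj₁ (t , t<n , Pt , none-before) = inj₁ (t , <-trans t<n (n<1+n n) , Pt , none-before)
... | inj₂ none with P? n
...   | yes Pn = inj₁ (n , n<1+n n , Pn , none)
...   | no ¬Pn = inj₂ none′
  where
  none′ : ∀ u → u < suc n → ¬ _
  none′ u u<n+1 with m≤n⇒m<n∨m≡n (≤-pred u<n+1)
  ... | inj₁ u<n = none u u<n
  ... | inj₂ refl = ¬Pn

firstWitness : ∀ {P : ℕ → Set} → Decidable P → ∀ {s} → P s → ∃ λ t → t ≤ s × P t × (∀ u → u < t → ¬ P u)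
firstWitness P? {s} Ps with firstBelow P? (suc s)
... | inj₁ (t , t<s+1 , Pt , none-before) = t , ≤-pred t<s+1 , Pt , none-before
... | inj₂ none = ⊥-elim (none s (n<1+n s) Ps)

filter-from-split : ∀ (cs : List Char) q j → (∀ t → t < q → proj₂ (at cs t) < j) →
                    (∀ t → q ≤ t → t < length cs → j ≤ proj₂ (at cs t)) →
                    filter (λ c → j ≤? proj₂ c) cs ≡ drop q cs
filter-from-split [] zero j _ _ = refl
filter-from-split [] (suc q) j _ _ = refl
filter-from-split (c ∷ cs) zero j _ from =
  trans (filter-accept (λ c → j ≤? proj₂ c) (from 0 z≤n (s≤s z≤n)))
        (cong (c ∷_) (filter-from-split cs zero j (λ _ ()) (λ t _ t<len → from (suc t) z≤n (s≤s t<len))))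
filter-from-split (c ∷ cs) (suc q) j before from =
  trans (filter-reject (λ c → j ≤? proj₂ c) (<⇒≱ (before 0 (s≤s z≤n))))
        (filter-from-split cs q j (λ t t<q → before (suc t) (s≤s t<q)) (λ t q≤t t<len → from (suc t) (s≤s q≤t) (s≤s t<len)))

module Word {m : ℕ} (S : Vec Elt m) where

  open OneWord S public

  len : ℕ
  len = length w

  C : ℕ → Ch
  C t = proj₁ (at w t)

  J : ℕ → ℕ
  J t = proj₂ (at w t)

  ch≡C : ∀ k → ch k ≡ C (toℕ k)
  ch≡C k = cong proj₁ (lookup≡at w k)

  src≡J : ∀ k → src k ≡ J (toℕ k)
  src≡J k = cong proj₂ (lookup≡at w k)

  pos : ∀ {t} → t < len → Pos
  pos t<len = fromℕ< t<len

  toℕ-pos : ∀ {t} (t<len : t < len) → toℕ (pos t<len) ≡ t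
  toℕ-pos t<len = toℕ-fromℕ< t<len

  adjacent : ∀ {t} → suc t < len → Adjacent (at w t) (at w (suc t))
  adjacent = linked-at (oneWord-linked (entries S) (entries-ascending S))

  C0≢dash : 0 < len → C 0 ≢ dash
  C0≢dash = first-paren w (oneWord-first (entries S) (All.tabulate (λ _ → z≤n)))

  J-step : ∀ {t} → suc t < len → J t ≤ J (suc t)
  J-step t+1<len with adjacent t+1<len
  ... | across j<j′ _ _ = <⇒≤ j<j′
  ... | rp-dash _ _ j≡j′ = ≤-reflexive j≡j′
  ... | dash-lp _ _ j≡j′ = ≤-reflexive j≡j′

  J-mono : ∀ {t t′} → t ≤ t′ → t′ < len → J t ≤ J t′
  J-mono {t′ = zero} z≤n _ = ≤-refl
  J-mono {t} {suc t′} t≤t′+1 t′+1<len with t ≤? t′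
  ... | yes t≤t′ = ≤-trans (J-mono t≤t′ (<-trans (n<1+n t′) t′+1<len)) (J-step t′+1<len)
  ... | no t≰t′ = ≤-reflexive (cong J (≤-antisym t≤t′+1 (≰⇒> t≰t′)))

  data BlockStart : ℕ → Set where
    first : BlockStart 0
    after : ∀ {t} → J t < J (suc t) → BlockStart (suc t)

  rp-blockStart : ∀ {t} → t < len → C t ≡ rp → BlockStart t
  rp-blockStart {zero} _ _ = first
  rp-blockStart {suc t} t+1<len Ct+1≡rp with adjacent t+1<len
  ... | across j<j′ _ _ = after j<j′
  ... | rp-dash _ Ct+1≡dash _ with () ← trans (sym Ct+1≡rp) Ct+1≡dash
  ... | dash-lp _ Ct+1≡lp _ with () ← trans (sym Ct+1≡rp) Ct+1≡lp

  lp-blockEnd : ∀ {t} → suc t < len → C t ≡ lp → J t < J (suc t)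
  lp-blockEnd t+1<len Ct≡lp with adjacent t+1<len
  ... | across j<j′ _ _ = j<j′
  ... | rp-dash Ct≡rp _ _ with () ← trans (sym Ct≡lp) Ct≡rp
  ... | dash-lp Ct≡dash _ _ with () ← trans (sym Ct≡lp) Ct≡dash

  dash-after-rp : ∀ {t} → t < len → C t ≡ dash → ∃ λ u → suc u ≡ t × J u ≡ J t × C u ≡ rp
  dash-after-rp {zero} 0<len C0≡dash = ⊥-elim (C0≢dash 0<len C0≡dash)
  dash-after-rp {suc u} u+1<len Cu+1≡dash with adjacent u+1<len
  ... | across _ _ Cu+1≢dash = ⊥-elim (Cu+1≢dash Cu+1≡dash)
  ... | rp-dash Cu≡rp _ Ju≡Ju+1 = u , refl , Ju≡Ju+1 , Cu≡rp
  ... | dash-lp _ Cu+1≡lp _ with () ← trans (sym Cu+1≡lp) Cu+1≡dash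

  lp-blockStart : ∀ {t} → t < len → C t ≡ lp → BlockStart t ⊎ ∃ λ u → u < t × J u ≡ J t × C u ≡ rp
  lp-blockStart {zero} _ _ = inj₁ first
  lp-blockStart {suc t} t+1<len Ct+1≡lp with adjacent t+1<len
  ... | across j<j′ _ _ = inj₁ (after j<j′)
  ... | rp-dash _ Ct+1≡dash _ with () ← trans (sym Ct+1≡lp) Ct+1≡dash
  ... | dash-lp Ct≡dash _ Jt≡Jt+1 with dash-after-rp (<-trans (n<1+n t) t+1<len) Ct≡dash
  ...   | u , refl , Ju≡Jt , Cu≡rp = inj₂ (u , <-trans (n<1+n u) (n<1+n t) , trans Ju≡Jt Jt≡Jt+1 , Cu≡rp)

  blockStart-of : ∀ {t} → t < len → ∃ λ q → q ≤ t × J q ≡ J t × BlockStart q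
  blockStart-of {zero} _ = 0 , ≤-refl , refl , first
  blockStart-of {suc t} t+1<len with J t <? J (suc t)
  ... | yes Jt<Jt+1 = suc t , ≤-refl , refl , after Jt<Jt+1
  ... | no Jt≮Jt+1 with blockStart-of (<-trans (n<1+n t) t+1<len)
  ...   | q , q≤t , Jq≡Jt , start =
    q , ≤-trans q≤t (n≤1+n t) , trans Jq≡Jt (≤-antisym (J-step t+1<len) (≮⇒≥ Jt≮Jt+1)) , start

  Splits : ℕ → ℕ → Set
  Splits q j = (∀ t → t < q → J t < j) × (∀ t → q ≤ t → t < len → j ≤ J t)

  blockStart-splits : ∀ {q} → BlockStart q → q < len → Splits q (J q)
  blockStart-splits first _ = (λ _ ()) , λ t _ t<len → J-mono z≤n t<len
  blockStart-splits (after {p} Jp<Jp+1) p+1<len =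
    (λ t t≤p → ≤-<-trans (J-mono (≤-pred t≤p) (<-trans (n<1+n p) p+1<len)) Jp<Jp+1) ,
    (λ t q≤t t<len → J-mono q≤t t<len)

  entry-of-lp : ∀ {t} → t < len → C t ≡ lp → ∃ λ s → (J t , s) ∈ₗ entries S × row2 ∈ s
  entry-of-lp t<len Ct≡lp with ∈-oneWord⁻ (entries S) (at-∈ w t<len)
  ... | s , e∈ , lp⇒row2 = s , e∈ , lp⇒row2 Ct≡lp

  entry-splits : ∀ {j s} → (j , s) ∈ₗ entries S → row2 ∈ s → ∃ λ q → q < len × Splits q j
  entry-splits e∈ row2∈s with ∈⇒at w (lp∈oneWord (entries S) e∈ row2∈s)
  ... | t , t<len , at≡lp with blockStart-of t<len
  ...   | q , q≤t , Jq≡Jt , start =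
    q , q<len , subst (Splits q) (trans Jq≡Jt (cong proj₂ at≡lp)) (blockStart-splits start q<len)
    where
    q<len : q < len
    q<len = ≤-<-trans q≤t t<len

  H : ℕ → ℤ
  H t = net (map proj₁ (take t w))

  net-++ : ∀ xs ys → net (xs ++ ys) ≡ net xs +ℤ net ys
  net-++ [] ys = sym (ℤₚ.+-identityˡ (net ys))
  net-++ (c ∷ xs) ys = trans (cong (val c +ℤ_) (net-++ xs ys)) (sym (ℤₚ.+-assoc (val c) (net xs) (net ys)))

  net-take-suc : ∀ (cs : List Char) {t} → t < length cs →
                 net (map proj₁ (take (suc t) cs)) ≡ net (map proj₁ (take t cs)) +ℤ val (proj₁ (at cs t))
  net-take-suc (c ∷ _) {zero} _ = trans (ℤₚ.+-identityʳ (val (proj₁ c))) (sym (ℤₚ.+-identityˡ (val (proj₁ c))))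
  net-take-suc (c ∷ cs) {suc t} (s≤s t<len) =
    trans (cong (val (proj₁ c) +ℤ_) (net-take-suc cs t<len)) (sym (ℤₚ.+-assoc (val (proj₁ c)) _ _))

  net-take-+ : ∀ (cs : List Char) i k →
               net (map proj₁ (take i cs)) +ℤ net (map proj₁ (take k (drop i cs))) ≡ net (map proj₁ (take (i + k) cs))
  net-take-+ cs zero k = ℤₚ.+-identityˡ _
  net-take-+ [] (suc i) zero = refl
  net-take-+ [] (suc i) (suc k) = refl
  net-take-+ (c ∷ cs) (suc i) k = trans (ℤₚ.+-assoc (val (proj₁ c)) _ _) (cong (val (proj₁ c) +ℤ_) (net-take-+ cs i k))

  segment : ℕ → ℕ → List Ch
  segment i n = map proj₁ (take n (drop i w))

  H-+ : ∀ i k → H i +ℤ net (segment i k) ≡ H (i + k)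
  H-+ = net-take-+ w

  take-segment : ∀ k i n → take k (segment i n) ≡ segment i (k ⊓ n)
  take-segment k i n = trans (take-map k (take n (drop i w))) (cong (map proj₁) (take-take k n (drop i w)))

  H-suc : ∀ {t} → t < len → H (suc t) ≡ H t +ℤ val (C t)
  H-suc = net-take-suc w

  H-lp : ∀ {t} → t < len → C t ≡ lp → H (suc t) ≡ sucℤ (H t)
  H-lp {t} t<len Ct≡lp = trans (H-suc t<len) (trans (cong (λ c → H t +ℤ val c) Ct≡lp) (ℤₚ.+-comm (H t) 1ℤ))

  H-rp : ∀ {t} → t < len → C t ≡ rp → H t ≡ sucℤ (H (suc t))
  H-rp {t} t<len Ct≡rp = begin
    H t                       ≡⟨ step-back (H t) ⟩
    1ℤ +ℤ (H t +ℤ - 1ℤ)       ≡⟨ cong (λ c → 1ℤ +ℤ (H t +ℤ val c)) Ct≡rp ⟨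
    1ℤ +ℤ (H t +ℤ val (C t))  ≡⟨ cong (1ℤ +ℤ_) (H-suc t<len) ⟨
    sucℤ (H (suc t))          ∎
    where
    open ≡-Reasoning
    step-back : ∀ h → h ≡ 1ℤ +ℤ (h +ℤ - 1ℤ)
    step-back = solve-∀

  H-dash : ∀ {t} → t < len → C t ≡ dash → H (suc t) ≡ H t
  H-dash {t} t<len Ct≡dash = trans (H-suc t<len) (trans (cong (λ c → H t +ℤ val c) Ct≡dash) (ℤₚ.+-identityʳ (H t)))

  H-up : ∀ {t v} → t < len → H t <ℤ v → v ≤ℤ H (suc t) → C t ≡ lp × H (suc t) ≡ v
  H-up {t} {v} t<len Ht<v v≤Ht+1 with C t in Ct≡
  ... | lp = refl , ℤₚ.≤-antisym (subst (_≤ℤ v) (sym (H-lp t<len Ct≡)) (ℤₚ.i<j⇒suc[i]≤j Ht<v)) v≤Ht+1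
  ... | rp = ⊥-elim (ℤₚ.<-asym Ht<v (ℤₚ.≤-<-trans v≤Ht+1 (subst (H (suc t) <ℤ_) (sym (H-rp t<len Ct≡)) (i<sucℤi _))))
  ... | dash = ⊥-elim (ℤₚ.<⇒≱ Ht<v (subst (v ≤ℤ_) (H-dash t<len Ct≡) v≤Ht+1))

  H-down : ∀ {t v} → t < len → H (suc t) <ℤ v → v ≤ℤ H t → C t ≡ rp × H t ≡ v
  H-down {t} {v} t<len Ht+1<v v≤Ht with C t in Ct≡
  ... | lp = ⊥-elim (ℤₚ.<-asym Ht+1<v (ℤₚ.≤-<-trans v≤Ht (subst (H t <ℤ_) (sym (H-lp t<len Ct≡)) (i<sucℤi _))))
  ... | rp = refl , ℤₚ.≤-antisym (subst (_≤ℤ v) (sym (H-rp t<len Ct≡)) (ℤₚ.i<j⇒suc[i]≤j Ht+1<v)) v≤Ht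
  ... | dash = ⊥-elim (ℤₚ.<⇒≱ Ht+1<v (subst (v ≤ℤ_) (sym (H-dash t<len Ct≡)) v≤Ht))

  record Matching (a b : ℕ) : Set where
    field
      ordered : a < b
      opens   : C a ≡ lp
      closes  : C b ≡ rp
      level   : H b ≡ H (suc a)
      floor   : ∀ t → suc a ≤ t → t ≤ b → H (suc a) ≤ℤ H t

  matched⇒matching : ∀ {a b} → Matched a b → Matching (toℕ a) (toℕ b)
  matched⇒matching {a} {b} (a<b , cha≡lp , chb≡rp , net≡0 , prefixes≥0) = record
    { ordered = a<b
    ; opens   = trans (sym (ch≡C a)) cha≡lp
    ; closes  = trans (sym (ch≡C b)) chb≡rp
    ; level   = level
    ; floor   = floor
    }
    where
    open ≡-Reasoning
    i : ℕ
    i = suc (toℕ a)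
    n : ℕ
    n = toℕ b ∸ i
    level : H (toℕ b) ≡ H i
    level = begin
      H (toℕ b)                  ≡⟨ cong H (m+[n∸m]≡n a<b) ⟨
      H (i + n)                  ≡⟨ H-+ i n ⟨
      H i +ℤ net (segment i n)   ≡⟨ cong (H i +ℤ_) net≡0 ⟩
      H i +ℤ 0ℤ                  ≡⟨ ℤₚ.+-identityʳ (H i) ⟩
      H i                        ∎
    floor : ∀ t → i ≤ t → t ≤ toℕ b → H i ≤ℤ H t
    floor t i≤t t≤b = subst (H i ≤ℤ_) (trans (H-+ i k) (cong H (m+[n∸m]≡n i≤t))) (0≤⇒≤+ (H i) prefix≥0)
      where
      k : ℕ
      k = t ∸ i
      prefix≥0 : 0ℤ ≤ℤ net (segment i k)
      prefix≥0 = subst (λ cs → 0ℤ ≤ℤ net cs)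
        (trans (take-segment k i n) (cong (segment i) (m≤n⇒m⊓n≡m (∸-monoˡ-≤ i t≤b)))) (prefixes≥0 k)

  matching⇒matched : ∀ {a b} → Matching (toℕ a) (toℕ b) → Matched a b
  matching⇒matched {a} {b} M = ordered , trans (ch≡C a) opens , trans (ch≡C b) closes , net≡0 , prefixes≥0
    where
    open Matching M
    i : ℕ
    i = suc (toℕ a)
    n : ℕ
    n = toℕ b ∸ i
    i+n≡b : i + n ≡ toℕ b
    i+n≡b = m+[n∸m]≡n ordered
    net≡0 : net (segment i n) ≡ 0ℤ
    net≡0 = +-cancel-≡0 (H i) (trans (H-+ i n) (trans (cong H i+n≡b) level))
    prefixes≥0 : ∀ k → 0ℤ ≤ℤ net (take k (segment i n))
    prefixes≥0 k = subst (λ cs → 0ℤ ≤ℤ net cs) (sym (take-segment k i n))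
      (≤+⇒0≤ (H i) (subst (H i ≤ℤ_) (sym (H-+ i (k ⊓ n)))
        (floor (i + k ⊓ n) (m≤m+n i _) (≤-trans (+-monoʳ-≤ i (m⊓n≤n k n)) (≤-reflexive i+n≡b)))))

  NoStraddle : ℕ → Set
  NoStraddle q = ∀ {a b} → Matched a b → toℕ a < q → q ≤ toℕ b → ⊥

  prefixMin⇒noStraddle : ∀ {q} → (∀ s → s ≤ q → H q ≤ℤ H s) → NoStraddle q
  prefixMin⇒noStraddle {q} minimal {a} a~b a<q q≤b = ℤₚ.<⇒≱ (i<sucℤi (H (toℕ a))) (begin
    sucℤ (H (toℕ a))  ≡⟨ H-lp (toℕ<n a) opens ⟨
    H (suc (toℕ a))   ≤⟨ floor q a<q q≤b ⟩
    H q               ≤⟨ minimal (toℕ a) (<⇒≤ a<q) ⟩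
    H (toℕ a)         ∎)
    where
    open Matching (matched⇒matching a~b)
    open ℤₚ.≤-Reasoning

  suffixMin⇒noStraddle : ∀ {q} → (∀ s → q ≤ s → s ≤ len → H q ≤ℤ H s) → NoStraddle q
  suffixMin⇒noStraddle {q} minimal {a} {b} a~b a<q q≤b = ℤₚ.<⇒≱ (i<sucℤi (H (suc (toℕ b)))) (begin
    sucℤ (H (suc (toℕ b)))  ≡⟨ H-rp (toℕ<n b) closes ⟨
    H (toℕ b)               ≡⟨ level ⟩
    H (suc (toℕ a))         ≤⟨ floor q a<q q≤b ⟩
    H q                     ≤⟨ minimal (suc (toℕ b)) (≤-trans q≤b (n≤1+n _)) (toℕ<n b) ⟩
    H (suc (toℕ b))         ∎)
    where
    open Matching (matched⇒matching a~b)
    open ℤₚ.≤-Reasoning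

  floor⇒unclosed : ∀ {u} (u<len : u < len) → (∀ v → u < v → v ≤ len → H (suc u) ≤ℤ H v) →
                   ¬ (∃ λ b → Matched (pos u<len) b)
  floor⇒unclosed {u} u<len floor-after (b , u~b) = ℤₚ.<⇒≱ (i<sucℤi (H (suc (toℕ b)))) (begin
    sucℤ (H (suc (toℕ b)))       ≡⟨ H-rp (toℕ<n b) closes ⟨
    H (toℕ b)                    ≡⟨ level ⟩
    H (suc (toℕ (pos u<len)))    ≡⟨ cong (λ t → H (suc t)) (toℕ-pos u<len) ⟩
    H (suc u)                    ≤⟨ floor-after (suc (toℕ b)) u<b+1 (toℕ<n b) ⟩
    H (suc (toℕ b))              ∎)
    where
    open Matching (matched⇒matching u~b)
    open ℤₚ.≤-Reasoning
    u<b+1 : u < suc (toℕ b)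
    u<b+1 = ≤-trans (subst (_< toℕ b) (toℕ-pos u<len) ordered) (n≤1+n _)

  Gen-sym : ∀ {u v} → Gen u v → Gen v u
  Gen-sym (pair a~b a≤u u≤b a≤v v≤b) = pair a~b a≤v v≤b a≤u u≤b
  Gen-sym (same src≡) = same (sym src≡)

  gen-before-cut : ∀ {q j} → NoStraddle q → Splits q j → ∀ {u v} → Gen u v → toℕ v < q → toℕ u < q
  gen-before-cut {q} no-straddle _ {u} (pair {a} a~b _ u≤b a≤v _) v<q with toℕ u <? q
  ... | yes u<q = u<q
  ... | no u≮q = ⊥-elim (no-straddle a~b (≤-<-trans a≤v v<q) (≤-trans (≮⇒≥ u≮q) u≤b))
  gen-before-cut {q} _ (before , from) {u} {v} (same src≡) v<q with toℕ u <? q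
  ... | yes u<q = u<q
  ... | no u≮q = ⊥-elim (<⇒≱ (before (toℕ v) v<q) (subst (_ ≤_) Ju≡Jv (from (toℕ u) (≮⇒≥ u≮q) (toℕ<n u))))
    where
    Ju≡Jv : J (toℕ u) ≡ J (toℕ v)
    Ju≡Jv = trans (sym (src≡J u)) (trans src≡ (src≡J v))

  class-before-cut : ∀ {q j} → NoStraddle q → Splits q j → ∀ {u v} → SameClass u v → toℕ v < q → toℕ u < q
  class-before-cut _ _ ε v<q = v<q
  class-before-cut no-straddle splits (fwd g ◅ rest) v<q =
    gen-before-cut no-straddle splits g (class-before-cut no-straddle splits rest v<q)
  class-before-cut no-straddle splits (bwd g ◅ rest) v<q =
    gen-before-cut no-straddle splits (Gen-sym g) (class-before-cut no-straddle splits rest v<q)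

  private
    shift : ∀ {N δ a b a′ b′} → N +ℤ + a ≡ + b → δ +ℤ + a′ ≡ + b′ → (δ +ℤ N) +ℤ + (a′ + a) ≡ + (b′ + b)
    shift {N} {δ} {a} {b} {a′} {b′} N+a≡b δ+a′≡b′ = begin
      (δ +ℤ N) +ℤ + (a′ + a)        ≡⟨ cong ((δ +ℤ N) +ℤ_) (ℤₚ.pos-+ a′ a) ⟩
      (δ +ℤ N) +ℤ (+ a′ +ℤ + a)     ≡⟨ interchange δ N (+ a′) (+ a) ⟩
      (δ +ℤ + a′) +ℤ (N +ℤ + a)     ≡⟨ cong₂ _+ℤ_ δ+a′≡b′ N+a≡b ⟩
      + b′ +ℤ + b                   ≡⟨ ℤₚ.pos-+ b′ b ⟨
      + (b′ + b)                    ∎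
      where
      open ≡-Reasoning
      interchange : ∀ δ N x y → (δ +ℤ N) +ℤ (x +ℤ y) ≡ (δ +ℤ x) +ℤ (N +ℤ y)
      interchange = solve-∀

    balance-step : ∀ {j j′ N} a′ b′ s (E : List Entry) →
      N +ℤ + countFromList E j row1 ≡ + countFromList E j row2 →
      net (map proj₁ (chars j′ s)) +ℤ + a′ ≡ + b′ →
      countFromList ((j′ , s) ∷ E) j row1 ≡ a′ + countFromList E j row1 →
      countFromList ((j′ , s) ∷ E) j row2 ≡ b′ + countFromList E j row2 →
      (net (map proj₁ (chars j′ s)) +ℤ N) +ℤ + countFromList ((j′ , s) ∷ E) j row1
        ≡ + countFromList ((j′ , s) ∷ E) j row2
    balance-step {j} {j′} {N} a′ b′ s E ih block count1 count2 =
      subst₂ (λ a b → (net (map proj₁ (chars j′ s)) +ℤ N) +ℤ + a ≡ + b) (sym count1) (sym count2)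
        (shift {N} {net (map proj₁ (chars j′ s))} {countFromList E j row1} {countFromList E j row2} ih block)

  block-balance : ∀ {j j′ N} s (E : List Entry) → j ≤ j′ →
                  N +ℤ + countFromList E j row1 ≡ + countFromList E j row2 →
                  (net (map proj₁ (chars j′ s)) +ℤ N) +ℤ + countFromList ((j′ , s) ∷ E) j row1
                    ≡ + countFromList ((j′ , s) ∷ E) j row2
  block-balance {N = N} s@(inside ∷ outside ∷ []) E j≤j′ ih =
    balance-step {N = N} 1 0 s E ih refl (countFrom-accept E j≤j′ here) (countFrom-∉ E λ { (there ()) })
  block-balance {N = N} s@(outside ∷ inside ∷ []) E j≤j′ ih =
    balance-step {N = N} 0 1 s E ih refl (countFrom-∉ E λ ()) (countFrom-accept E j≤j′ (there here))
  block-balance {N = N} s@(inside ∷ inside ∷ []) E j≤j′ ih =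
    balance-step {N = N} 1 1 s E ih refl (countFrom-accept E j≤j′ here) (countFrom-accept E j≤j′ (there here))
  block-balance {N = N} s@(outside ∷ outside ∷ []) E j≤j′ ih =
    balance-step {N = N} 0 0 s E ih refl (countFrom-∉ E λ ()) (countFrom-∉ E λ { (there ()) })

  suffix-balance : ∀ j (E : List Entry) →
                   net (map proj₁ (filter (λ c → j ≤? proj₂ c) (oneWord E))) +ℤ + countFromList E j row1
                     ≡ + countFromList E j row2
  suffix-balance j [] = refl
  suffix-balance j ((j′ , s) ∷ E) = begin
    net (map proj₁ (filter P? (chars j′ s ++ oneWord E))) +ℤ + c1  ≡⟨ cong (λ cs → net cs +ℤ + c1) split ⟩
    net (map proj₁ here-part ++ rest) +ℤ + c1                     ≡⟨ cong (_+ℤ + c1) (net-++ (map proj₁ here-part) rest) ⟩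
    (net (map proj₁ here-part) +ℤ net rest) +ℤ + c1               ≡⟨ by-cases (j ≤? j′) ⟩
    + c2                                                           ∎
    where
    open ≡-Reasoning
    P? : Decidable (λ (c : Char) → j ≤ proj₂ c)
    P? = λ (c : Char) → j ≤? proj₂ c
    here-part : List Char
    here-part = filter P? (chars j′ s)
    rest : List Ch
    rest = map proj₁ (filter P? (oneWord E))
    split : map proj₁ (filter P? (chars j′ s ++ oneWord E)) ≡ map proj₁ here-part ++ rest
    split = trans (cong (map proj₁) (filter-++ P? (chars j′ s) (oneWord E))) (map-++ proj₁ here-part (filter P? (oneWord E)))
    c1 : ℕ
    c1 = countFromList ((j′ , s) ∷ E) j row1
    c2 : ℕ
    c2 = countFromList ((j′ , s) ∷ E) j row2
    ih : net rest +ℤ + countFromList E j row1 ≡ + countFromList E j row2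
    ih = suffix-balance j E
    by-cases : Dec (j ≤ j′) → (net (map proj₁ here-part) +ℤ net rest) +ℤ + c1 ≡ + c2
    by-cases (yes j≤j′) = subst (λ cs → (net (map proj₁ cs) +ℤ net rest) +ℤ + c1 ≡ + c2)
      (sym (filter-all P? (All.tabulate (λ c∈ → subst (j ≤_) (sym (proj₁ (∈-chars {s = s} c∈))) j≤j′))))
      (block-balance s E j≤j′ ih)
    by-cases (no j≰j′) = begin
      (net (map proj₁ here-part) +ℤ net rest) +ℤ + c1
        ≡⟨ cong (λ cs → (net (map proj₁ cs) +ℤ net rest) +ℤ + c1)
                (filter-none P? (All.tabulate (λ c∈ → subst (¬_ ∘ (j ≤_)) (sym (proj₁ (∈-chars {s = s} c∈))) j≰j′))) ⟩
      (0ℤ +ℤ net rest) +ℤ + c1                ≡⟨ cong (_+ℤ + c1) (ℤₚ.+-identityˡ (net rest)) ⟩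
      net rest +ℤ + c1                        ≡⟨ cong (λ c → net rest +ℤ + c) (countFrom-below E (≰⇒> j≰j′)) ⟩
      net rest +ℤ + countFromList E j row1    ≡⟨ ih ⟩
      + countFromList E j row2                ≡⟨ cong +_ (countFrom-below E (≰⇒> j≰j′)) ⟨
      + c2                                    ∎

  split-balance : ∀ {q j} → Splits q j → H len +ℤ + countFrom S j row1 ≡ H q +ℤ + countFrom S j row2
  split-balance {q} {j} (before , from) = begin
    H len +ℤ + c1                                ≡⟨ cong (_+ℤ + c1) H-len ⟩
    (H q +ℤ net (map proj₁ (drop q w))) +ℤ + c1  ≡⟨ ℤₚ.+-assoc (H q) _ (+ c1) ⟩
    H q +ℤ (net (map proj₁ (drop q w)) +ℤ + c1)  ≡⟨ cong (λ cs → H q +ℤ (net (map proj₁ cs) +ℤ + c1)) suffix≡drop ⟨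
    H q +ℤ (net (map proj₁ suffix) +ℤ + c1)      ≡⟨ cong (H q +ℤ_) (suffix-balance j (entries S)) ⟩
    H q +ℤ + countFrom S j row2                  ∎
    where
    open ≡-Reasoning
    c1 : ℕ
    c1 = countFrom S j row1
    suffix : List Char
    suffix = filter (λ c → j ≤? proj₂ c) w
    suffix≡drop : suffix ≡ drop q w
    suffix≡drop = filter-from-split w q j before from
    H-len : H len ≡ H q +ℤ net (map proj₁ (drop q w))
    H-len = begin
      H len                                                ≡⟨ cong (λ cs → net (map proj₁ cs)) (take-all len w ≤-refl) ⟩
      net (map proj₁ w)                                    ≡⟨ cong (λ cs → net (map proj₁ cs)) (take++drop≡id q w) ⟨
      net (map proj₁ (take q w ++ drop q w))               ≡⟨ cong net (map-++ proj₁ (take q w) (drop q w)) ⟩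
      net (map proj₁ (take q w) ++ map proj₁ (drop q w))   ≡⟨ net-++ (map proj₁ (take q w)) (map proj₁ (drop q w)) ⟩
      H q +ℤ net (map proj₁ (drop q w))                    ∎

module _ {m : ℕ} (S : Vec Elt m) where

  open Word S

  -- A last position below H y before y would open a pair closed at y.
  unmatched-rp-minimal : ∀ (y : Pos) → C (toℕ y) ≡ rp → ¬ (∃ λ a → Matched a y) →
                         ∀ s → s ≤ toℕ y → H (toℕ y) ≤ℤ H s
  unmatched-rp-minimal y Cy≡rp no-opener s s≤y with H (toℕ y) ℤ.≤? H s
  ... | yes ok = ok
  ... | no Hy≰Hs
    with lastWitness (λ u → H u ℤ.<? H (toℕ y)) (≤∧≢⇒< s≤y λ { refl → ℤₚ.<-irrefl refl (ℤₚ.≰⇒> Hy≰Hs) })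
                     (ℤₚ.≰⇒> Hy≰Hs)
  ...   | u , _ , u<y , Hu<Hy , none-after = ⊥-elim (no-opener (pos u<len , matching⇒matched opening))
    where
    u<len : u < len
    u<len = <-trans u<y (toℕ<n y)
    above : ∀ t → u < t → t ≤ toℕ y → H (toℕ y) ≤ℤ H t
    above t u<t t≤y with m≤n⇒m<n∨m≡n t≤y
    ... | inj₁ t<y = ℤₚ.≮⇒≥ (none-after t u<t t<y)
    ... | inj₂ refl = ℤₚ.≤-refl
    up : C u ≡ lp × H (suc u) ≡ H (toℕ y)
    up = H-up u<len Hu<Hy (above (suc u) ≤-refl u<y)
    opening : Matching (toℕ (pos u<len)) (toℕ y)
    opening rewrite toℕ-pos u<len = record
      { ordered = u<y
      ; opens   = proj₁ up
      ; closes  = Cy≡rp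
      ; level   = sym (proj₂ up)
      ; floor   = λ t u<t t≤y → subst (_≤ℤ H t) (sym (proj₂ up)) (above t u<t t≤y)
      }

  module LastClass {c x : Pos} (last : IsLast c) (c~x : SameClass c x) where

    X : ℕ
    X = toℕ x

    no-cut-after-first : ∀ {q j} → X < q → q < len → NoStraddle q → Splits q j → ⊥
    no-cut-after-first X<q q<len no-straddle splits =
      <⇒≱ (class-before-cut no-straddle splits c~x X<q) (≤-pred (subst (suc _ ≤_) (sym last) q<len))

    -- The last position below H len would hold an unmatched "(" of the class: either the final
    -- character itself, or one followed by a cut.
    end-minimal : (∀ y → SameClass c y → ch y ≡ lp → ¬ Unmatched y) → ∀ t → X ≤ t → t ≤ len → H len ≤ℤ H t
    end-minimal no-open t X≤t t≤len with H len ℤ.≤? H t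
    ... | yes ok = ok
    ... | no Hlen≰Ht
      with lastWitness (λ u → H u ℤ.<? H len) (≤∧≢⇒< t≤len λ { refl → ℤₚ.<-irrefl refl (ℤₚ.≰⇒> Hlen≰Ht) })
                       (ℤₚ.≰⇒> Hlen≰Ht)
    ...   | u , t≤u , u<len , Hu<Hlen , none-after = ⊥-elim (by-cases (suc u ≟ len))
      where
      above : ∀ v → u < v → v ≤ len → H len ≤ℤ H v
      above v u<v v≤len with m≤n⇒m<n∨m≡n v≤len
      ... | inj₁ v<len = ℤₚ.≮⇒≥ (none-after v u<v v<len)
      ... | inj₂ refl = ℤₚ.≤-refl
      up : C u ≡ lp × H (suc u) ≡ H len
      up = H-up u<len Hu<Hlen (above (suc u) ≤-refl u<len)
      floor-after : ∀ v → u < v → v ≤ len → H (suc u) ≤ℤ H v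
      floor-after v u<v v≤len = subst (_≤ℤ H v) (sym (proj₂ up)) (above v u<v v≤len)
      y : Pos
      y = pos u<len
      y-lp : ch y ≡ lp
      y-lp = trans (ch≡C y) (trans (cong C (toℕ-pos u<len)) (proj₁ up))
      no-opener : ¬ (∃ λ a → Matched a y)
      no-opener (a , a~y) with () ← trans (sym y-lp) (proj₁ (proj₂ (proj₂ a~y)))
      by-cases : Dec (suc u ≡ len) → ⊥
      by-cases (yes u+1≡len) = no-open y (subst (SameClass c) c≡y ε) y-lp (floor⇒unclosed u<len floor-after , no-opener)
        where
        c≡y : c ≡ y
        c≡y = toℕ-injective (trans (suc-injective (trans last (sym u+1≡len))) (sym (toℕ-pos u<len)))
      by-cases (no u+1≢len) = no-cut-after-first (s≤s (≤-trans X≤t t≤u)) u+1<len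
        (suffixMin⇒noStraddle floor-after)
        (blockStart-splits (after (lp-blockEnd u+1<len (proj₁ up))) u+1<len)
        where
        u+1<len : suc u < len
        u+1<len = ≤∧≢⇒< u<len u+1≢len

    end-below-later-splits : (∀ t → X ≤ t → t ≤ len → H len ≤ℤ H t) →
                             ∀ {q j} → X < q → q < len → Splits q j → H len <ℤ H q
    end-below-later-splits suffix {q} X<q q<len splits with H len ℤ.<? H q
    ... | yes Hlen<Hq = Hlen<Hq
    ... | no Hlen≮Hq = ⊥-elim (no-cut-after-first X<q q<len (suffixMin⇒noStraddle q-min) splits)
      where
      q-min : ∀ s → q ≤ s → s ≤ len → H q ≤ℤ H s
      q-min s q≤s s≤len = ℤₚ.≤-trans (ℤₚ.≮⇒≥ Hlen≮Hq) (suffix s (≤-trans (<⇒≤ X<q) q≤s) s≤len)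

  rightForm-tableau : EndsWithRightForm S →
                      length (tabRow S row2) < length (tabRow S row1)
                      × (∀ k → 1 ≤ k → k ≤ length (tabRow S row2) → Dominated S k)
  rightForm-tableau (c , last , no-open , x , c~x , _ , _ , chx≡rp , x-unmatched) = shorter , dominated
    where
    open LastClass last c~x
    Cx≡rp : C X ≡ rp
    Cx≡rp = trans (sym (ch≡C x)) chx≡rp
    end<x : H len <ℤ H X
    end<x = ℤₚ.≤-<-trans (end-minimal no-open (suc X) (n≤1+n X) (toℕ<n x))
                         (subst (H (suc X) <ℤ_) (sym (H-rp (toℕ<n x) Cx≡rp)) (i<sucℤi _))
    end-below : ∀ {q j} → q < len → Splits q j → H len <ℤ H q
    end-below {q} q<len splits with q ≤? X
    ... | yes q≤X = ℤₚ.<-≤-trans end<x (unmatched-rp-minimal x Cx≡rp (proj₂ x-unmatched) q q≤X)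
    ... | no q≰X = end-below-later-splits (end-minimal no-open) (≰⇒> q≰X) q<len splits
    everything : Splits 0 0
    everything = (λ _ ()) , λ _ _ _ → z≤n
    shorter : length (tabRow S row2) < length (tabRow S row1)
    shorter = subst₂ _<_ (sym (tabRow-length S row2)) (sym (tabRow-length S row1))
      (count-gap (split-balance everything) (end-below (≤-<-trans z≤n (toℕ<n x)) everything))
    dominated : ∀ k → 1 ≤ k → k ≤ length (tabRow S row2) → Dominated S k
    dominated (suc k) 1≤k k≤p
      with countFrom-find (entries S) (entries-ascending S) 1≤k (subst (suc k ≤_) (tabRow-length S row2) k≤p)
    ... | j , s , j∈S , row2∈s , count≡k with entry-splits j∈S row2∈s
    ...   | q , q<len , splits =
      dominated-column S j∈S row2∈s count≡k (count-gap (split-balance splits) (end-below q<len splits))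

  module NullClass {c x : Pos} {i : ℕ} (last : IsLast c) (null : NullForm c) (c~x : SameClass c x) (x-paren : IsParen x)
                   (src≡i : src x ≡ i)
                   (x-first : ∀ y → SameClass c y → IsParen y → toℕ x ≤ toℕ y) where

    open LastClass last c~x public

    precedes-first : ∀ {y} → SameClass c y → IsParen y → toℕ y < X → ⊥
    precedes-first c~y y-paren y<X = <⇒≱ y<X (x-first _ c~y y-paren)

    opener-precedes-first : ∀ {a b} → Matched a b → toℕ a < X → X ≤ toℕ b → ⊥
    opener-precedes-first {a} a~b a<X X≤b = precedes-first c~a a-paren a<X
      where
      c~a : SameClass c a
      c~a = c~x ◅◅ (fwd (pair a~b (<⇒≤ a<X) X≤b ≤-refl (<⇒≤ (proj₁ a~b))) ◅ ε)
      a-paren : IsParen a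
      a-paren cha≡dash with () ← trans (sym (proj₁ (proj₂ a~b))) cha≡dash

    Cx≡lp : C X ≡ lp
    Cx≡lp with C X in Cx≡
    ... | lp = refl
    ... | dash = ⊥-elim (x-paren (trans (ch≡C x) Cx≡))
    ... | rp = ⊥-elim (null x c~x x-paren (no-closer , no-opener))
      where
      no-closer : ¬ (∃ λ b → Matched x b)
      no-closer (b , x~b) with () ← trans (sym Cx≡) (trans (sym (ch≡C x)) (proj₁ (proj₂ x~b)))
      no-opener : ¬ (∃ λ a → Matched a x)
      no-opener (a , a~x) = opener-precedes-first a~x (proj₁ a~x) ≤-refl

    x-blockStart : BlockStart X
    x-blockStart with lp-blockStart (toℕ<n x) Cx≡lp
    ... | inj₁ start = start
    ... | inj₂ (u , u<X , Ju≡Jx , Cu≡rp) = ⊥-elim (precedes-first c~u u-paren (subst (_< X) (sym (toℕ-pos u<len)) u<X))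
      where
      u<len : u < len
      u<len = <-trans u<X (toℕ<n x)
      c~u : SameClass c (pos u<len)
      c~u = c~x ◅◅ (fwd (same src≡) ◅ ε)
        where
        src≡ : src x ≡ src (pos u<len)
        src≡ = trans (src≡J x) (trans (sym Ju≡Jx) (trans (cong J (sym (toℕ-pos u<len))) (sym (src≡J _))))
      u-paren : IsParen (pos u<len)
      u-paren chu≡dash with () ← trans (sym Cu≡rp) (trans (cong C (sym (toℕ-pos u<len))) (trans (sym (ch≡C _)) chu≡dash))

    -- The ")" at y could be matched neither from inside [X, y] (by height) nor from before x (by
    -- minimality of x), and unmatched it would be a cut.
    no-closer-at-level : ∀ {y} → y < len → X < y → C y ≡ rp → H y ≡ H X →
                         (∀ a → X ≤ a → a ≤ y → H X ≤ℤ H a) → ⊥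
    no-closer-at-level {y} y<len X<y Cy≡rp Hy≡HX above-X = closer-unmatched closer-matched
      where
      z : Pos
      z = pos y<len
      z≡y : toℕ z ≡ y
      z≡y = toℕ-pos y<len
      closer-matched : (∃ λ a → Matched a z) → ⊥
      closer-matched (a , a~z) with X ≤? toℕ a
      ... | no X≰a = opener-precedes-first a~z (≰⇒> X≰a) (subst (X ≤_) (sym z≡y) (<⇒≤ X<y))
      ... | yes X≤a = ℤₚ.<⇒≱ (i<sucℤi (H (toℕ a))) (begin
        sucℤ (H (toℕ a))  ≡⟨ H-lp (toℕ<n a) opens ⟨
        H (suc (toℕ a))   ≡⟨ level ⟨
        H (toℕ z)         ≡⟨ cong H z≡y ⟩
        H y               ≡⟨ Hy≡HX ⟩
        H X               ≤⟨ above-X (toℕ a) X≤a (<⇒≤ (subst (toℕ a <_) z≡y ordered)) ⟩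
        H (toℕ a)         ∎)
        where
        open Matching (matched⇒matching a~z)
        open ℤₚ.≤-Reasoning
      closer-unmatched : ¬ (∃ λ a → Matched a z) → ⊥
      closer-unmatched no-opener = no-cut-after-first X<y y<len
        (subst NoStraddle z≡y (prefixMin⇒noStraddle (unmatched-rp-minimal z (trans (cong C z≡y) Cy≡rp) no-opener)))
        (blockStart-splits (rp-blockStart y<len Cy≡rp) y<len)

    -- The first descent below H X would be a ")" as excluded by no-closer-at-level.
    first-minimal : ∀ t → X ≤ t → t ≤ len → H X ≤ℤ H t
    first-minimal t X≤t t≤len with H X ℤ.≤? H t
    ... | yes ok = ok
    ... | no HX≰Ht with firstWitness (λ u → (X ≤? u) ×-dec (H u ℤ.<? H X)) (X≤t , ℤₚ.≰⇒> HX≰Ht)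
    ...   | zero , _ , (X≤0 , H0<HX) , _ = ⊥-elim (ℤₚ.<-irrefl (cong H (sym (n≤0⇒n≡0 X≤0))) H0<HX)
    ...   | suc y , y<t , (X≤y+1 , Hy+1<HX) , none-before =
      ⊥-elim (no-closer-at-level y<len (≤∧≢⇒< X≤y X≢y) (proj₁ down) (proj₂ down) above-X)
      where
      X≤y : X ≤ y
      X≤y = ≤-pred (≤∧≢⇒< X≤y+1 λ X≡y+1 → ℤₚ.<-irrefl (cong H (sym X≡y+1)) Hy+1<HX)
      y<len : y < len
      y<len = ≤-trans y<t t≤len
      above-X : ∀ a → X ≤ a → a ≤ y → H X ≤ℤ H a
      above-X a X≤a a≤y = ℤₚ.≮⇒≥ (λ Ha<HX → none-before a (s≤s a≤y) (X≤a , Ha<HX))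
      down : C y ≡ rp × H y ≡ H X
      down = H-down y<len Hy+1<HX (above-X y X≤y ≤-refl)
      X≢y : X ≢ y
      X≢y X≡y with () ← trans (sym Cx≡lp) (trans (cong C X≡y) (proj₁ down))

    no-open : ∀ y → SameClass c y → ch y ≡ lp → ¬ Unmatched y
    no-open y c~y chy≡lp = null y c~y y-paren
      where
      y-paren : IsParen y
      y-paren chy≡dash with () ← trans (sym chy≡lp) chy≡dash

    end-level : H len ≡ H X
    end-level = ℤₚ.≤-antisym (end-minimal no-open X ≤-refl (<⇒≤ (toℕ<n x)))
                             (first-minimal len (<⇒≤ (toℕ<n x)) ≤-refl)

    Jx≡i : J X ≡ i
    Jx≡i = trans (sym (src≡J x)) src≡i

    balanced : countFrom S i row1 ≡ countFrom S i row2
    balanced = +-cancelˡ-pos (H X) (trans (cong (_+ℤ + countFrom S i row1) (sym end-level)) (split-balance x-splits))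
      where
      x-splits : Splits X i
      x-splits = subst (Splits X) Jx≡i (blockStart-splits x-blockStart (toℕ<n x))

    x-entry : ∃ λ s → (i , s) ∈ₗ entries S × row2 ∈ s
    x-entry = subst (λ j → ∃ λ s → (j , s) ∈ₗ entries S × row2 ∈ s) Jx≡i (entry-of-lp (toℕ<n x) Cx≡lp)

    r : ℕ
    r = countFrom S (suc i) row2

    count2≡ : countFrom S i row2 ≡ suc r
    count2≡ = countFrom-step (entries S) (entries-ascending S) (proj₁ (proj₂ x-entry)) (proj₂ (proj₂ x-entry))

    count1≡ : countFrom S i row1 ≡ suc r
    count1≡ = trans balanced count2≡

    row2-entry : entry S row2 (suc r) ≡ just (suc m ∸ i)
    row2-entry = entry-of-count S r (proj₁ (proj₂ x-entry)) (proj₂ (proj₂ x-entry)) count2≡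

    stops : StopCond S (suc r)
    stops with count≤⇒entry> S (suc r) (≤-trans (entries-bounded S (proj₁ (proj₂ x-entry))) (n≤1+n m)) (≤-reflexive count1≡)
    ... | inj₁ none = inj₁ none
    ... | inj₂ (b , row1-entry , m+1∸i<b) = inj₂ (suc m ∸ i , b , row2-entry , row1-entry , m+1∸i<b)

    no-earlier-stop : ∀ k → 1 ≤ k → k < suc r → ¬ StopCond S k
    no-earlier-stop (suc k) 1≤k k<r+1
      with countFrom-find (entries S) (entries-ascending S) 1≤k
             (≤-trans (<⇒≤ (subst (suc k <_) (sym count2≡) k<r+1)) (countFrom-antitone (entries S) z≤n))
    ... | j , s , j∈S , row2∈s , count≡k with entry-splits j∈S row2∈s
    ...   | q , q<len , splits@(_ , from-q) with j ≤? i | q ≤? X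
    ...     | yes j≤i | _ = ⊥-elim (<⇒≱ k<r+1 (subst₂ _≤_ count2≡ count≡k (countFrom-antitone (entries S) j≤i)))
    ...     | no j≰i | yes q≤X = ⊥-elim (<⇒≱ (≰⇒> j≰i) (subst (j ≤_) Jx≡i (from-q X q≤X (toℕ<n x))))
    ...     | no _ | no q≰X = dominated⇒¬StopCond S (dominated-column S j∈S row2∈s count≡k
      (count-gap (split-balance splits) (end-below-later-splits (end-minimal no-open) (≰⇒> q≰X) q<len splits)))

  nullForm-tableau : ∀ i → EndsWithNullFormAt S i →
                     countFrom S i row1 ≡ countFrom S i row2
                     × entry S row2 (countFrom S i row1) ≡ just (suc m ∸ i)
                     × 1 ≤ countFrom S i row1
                     × StopCond S (countFrom S i row1)
                     × (∀ k → 1 ≤ k → k < countFrom S i row1 → ¬ StopCond S k)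
  nullForm-tableau i (c , last , null , x , c~x , x-paren , src≡i , x-first) =
    balanced ,
    subst (λ n → entry S row2 n ≡ just (suc m ∸ i) × 1 ≤ n × StopCond S n × (∀ k → 1 ≤ k → k < n → ¬ StopCond S k))
      (sym count1≡) (row2-entry , s≤s z≤n , stops , no-earlier-stop)
    where open NullClass last null c~x x-paren src≡i x-first

lemma2p20 :
    -- (a)
    (∀ (m : ℕ) (S : Vec Elt m) (i : ℕ) → HighestWeight S → EndsWithNullFormAt S i →
      countFrom S i row1 ≡ countFrom S i row2
      × entry S row2 (countFrom S i row1) ≡ just (suc m ∸ i)
      × 1 ≤ countFrom S i row1
      × StopCond S (countFrom S i row1)
      × (∀ k → 1 ≤ k → k < countFrom S i row1 → ¬ StopCond S k))
    ×
    -- (b)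
    (∀ (m : ℕ) (S : Vec Elt m) → HighestWeight S → EndsWithRightForm S →
      length (tabRow S row2) < length (tabRow S row1)
      × (∀ k → 1 ≤ k → k ≤ length (tabRow S row2) →
           ∃ λ a → ∃ λ b → entry S row2 k ≡ just a × entry S row1 (suc k) ≡ just b × b ≤ a))
lemma2p20 = (λ m S i _ → nullForm-tableau S i) , (λ m S _ → rightForm-tableau S)
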